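{- In the setting described in the context, the maps $\sigma\colon Y\times Z\to 2^G$ and $\rho\colon 2^G\to S(G)$ are equivariant for both the left and the right actions of $G$ on the respective spaces.
   Context: $G$ is a countable residually finite group and $G=H_0\ge H_1\ge H_2\ge\cdots$ is a decreasing sequence of finite index normal subgroups of $G$ with $\bigcap_n H_n=\{1_G\}$. Let $\hat G=\varprojlim G/H_n$ (so $G\subseteq\hat G$) with projections $\pi_n\colon\hat G\to G/H_n$. For $n\ge1$ let $A_n=(H_{n-1}/H_n)\setminus\{H_n\}$, let $Z=2^{\bigsqcup_{n\ge1}A_n}$ and $Y=\hat G\setminus G$. Define $\sigma\colon Y\times Z\to 2^G$ by $\sigma(y,z)(h)=z(\pi_{n_0}(y^{ -1}h))$ where $n_0=\min\{n:\pi_n(y)\ne\pi_n(h)\}$, and $\rho\colon 2^G\to S(G)$ by $\rho(x)=\overline{G\cdot x}$, where $S(G)$ is the set of closed nonempty left-invariant subsets of $2^G$. Left and right actions of $G$ on $2^G$: $(g\cdot x)(h)=x(g^{ -1}h)$, $(x\cdot g)(h)=x(hg^{ -1})$; on $S(G)$: $g\cdot S=S$ (left) and $S\cdot g=\{x\cdot g:x\in S\}$ (right). On $Y$: $g\cdot y=gy$, $y\cdot g=yg$. On $Z$: $g\cdot z=z$ and $(z\cdot g)(a)=z(gag^{ -1})$ for $a\in\bigsqcup_nA_n$. $Y\times Z$ carries the diagonal left and right actions. -}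

module Defs where

open import Data.Nat using (ℕ; suc; _<_)
open import Data.Bool using (Bool)
open import Data.List using (List)
open import Data.List.Membership.Propositional using (_∈_)
open import Data.Product using (Σ; ∃; ∃-syntax; _×_)
open import Relation.Nullary using (¬_)
open import Relation.Binary.PropositionalEquality using (_≡_)
open import Algebra.Structures using (IsGroup)
open import Function.Bundles using (_⇔_)

record Setting : Set₁ where
  field
    G       : Set
    _∙_     : G → G → G
    ε       : G
    _⁻¹     : G → G
    isGroup : IsGroup _≡_ _∙_ ε _⁻¹
    countable : Σ (ℕ → G) (λ f → ∀ (g : G) → Σ ℕ (λ n → f n ≡ g))
    H        : ℕ → G → Set
    H-ε      : ∀ n → H n ε
    H-∙      : ∀ n {a b} → H n a → H n b → H n (a ∙ b)
    H-⁻¹     : ∀ n {a} → H n a → H n (a ⁻¹)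
    H-normal : ∀ n {a} (k : G) → H n a → H n ((k ∙ a) ∙ (k ⁻¹))
    H-finIdx : ∀ n → Σ (List G) (λ reps → ∀ (g : G) → Σ G (λ r → r ∈ reps × H n ((r ⁻¹) ∙ g)))
    H-zero   : ∀ (g : G) → H 0 g
    H-decr   : ∀ n {a} → H (suc n) a → H n a
    H-triv   : ∀ (g : G) → (∀ n → H n g) → g ≡ ε

module _ (S : Setting) where
  open Setting S

  2^G : Set
  2^G = G → Bool

  _·ˡ_ : G → 2^G → 2^G
  (g ·ˡ x) h = x ((g ⁻¹) ∙ h)

  _·ʳ_ : 2^G → G → 2^G
  (x ·ʳ g) h = x (h ∙ (g ⁻¹))

  -- Elements of Ĝ = lim G/H n are represented by sequences y with y n a
  -- representative of π_n(y) ∈ G/H n, subject to compatibility.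
  Seq : Set
  Seq = ℕ → G

  IsĜ : Seq → Set
  IsĜ y = ∀ n → H n ((y n ⁻¹) ∙ y (suc n))

  SameCoset : Seq → ℕ → G → Set
  SameCoset y n h = H n ((y n ⁻¹) ∙ h)

  -- Y = Ĝ ∖ G  (y is not equal in Ĝ to the image of any g ∈ G)
  IsY : Seq → Set
  IsY y = IsĜ y × (∀ (g : G) → ¬ (∀ n → SameCoset y n g))

  _·Ŷˡ_ : G → Seq → Seq
  (g ·Ŷˡ y) n = g ∙ y n

  _·Ŷʳ_ : Seq → G → Seq
  (y ·Ŷʳ g) n = y n ∙ g

  -- Z = 2^(⊔_{n≥1} A_n), A_n = (H_{n-1}/H_n) ∖ {H_n}.  An element is
  -- represented by z : ℕ → G → Bool, where z n a is the value at the coset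
  -- a H_n ∈ A_n (for a ∈ H_{n-1} ∖ H_n); it must depend only on the coset.
  Zraw : Set
  Zraw = ℕ → G → Bool

  IsZ : Zraw → Set
  IsZ z = ∀ n {a a'} → H n a → ¬ H (suc n) a → H (suc n) ((a ⁻¹) ∙ a') →
            z (suc n) a ≡ z (suc n) a'
    -- (for n ≥ 1 we index A_(suc n) by suc n; values outside A_n are junk)

  -- right action on Z: (z·g)(a) = z(g a g⁻¹); the left action is trivial
  _·Zʳ_ : Zraw → G → Zraw
  (z ·Zʳ g) n a = z n ((g ∙ a) ∙ (g ⁻¹))

  σ-graph : Seq → Zraw → G → Bool → Set
  σ-graph y z h b =
    ∃[ n₀ ] ( ¬ SameCoset y n₀ h
            × (∀ m → m < n₀ → SameCoset y m h)
            × z n₀ ((y n₀ ⁻¹) ∙ h) ≡ b )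

  -- ρ(x) = closure of G·x in 2^G (product topology): w ∈ ρ(x) iff every
  -- basic neighbourhood of w (determined by a finite F ⊆ G) meets G·x.
  InRho : 2^G → 2^G → Set
  InRho x w = ∀ (F : List G) → ∃[ k ] (∀ h → h ∈ F → (k ·ˡ x) h ≡ w h)

  InRightTranslate : (2^G → Set) → G → 2^G → Set
  InRightTranslate P g w = ∃[ v ] (P v × (∀ h → w h ≡ (v ·ʳ g) h))

  Lemma4-1 : Set
  Lemma4-1 =
      (∀ (y : Seq) (z : Zraw) → IsY y → IsZ z → ∀ (g h : G) (b : Bool) →
          σ-graph (g ·Ŷˡ y) z h b ⇔ σ-graph y z ((g ⁻¹) ∙ h) b)
    ×
      (∀ (y : Seq) (z : Zraw) → IsY y → IsZ z → ∀ (g h : G) (b : Bool) →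
          σ-graph (y ·Ŷʳ g) (z ·Zʳ g) h b ⇔ σ-graph y z (h ∙ (g ⁻¹)) b)
    ×
      (∀ (x : 2^G) (g : G) (w : 2^G) → InRho (g ·ˡ x) w ⇔ InRho x w)
    ×
      (∀ (x : 2^G) (g : G) (w : 2^G) →
          InRho (x ·ʳ g) w ⇔ InRightTranslate (InRho x) g w)

module Submission where

open import Defs
open import Data.Bool using (Bool)
open import Data.List using (map)
open import Data.List.Membership.Propositional.Properties using (∈-map⁺)
open import Data.Product using (∃-syntax; _,_)
open import Function.Bundles using (_⇔_; mk⇔; Equivalence)
open import Function.Construct.Identity using (⇔-id)
open import Function.Construct.Composition using (_⇔-∘_)
open import Relation.Binary.PropositionalEquality
open import Algebra.Bundles using (Group)
import Algebra.Properties.Group as GroupProperties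

-- The graph of σ is equivariant for arbitrary sequences y and z: it only depends on the relative positions (y n)⁻¹ h,
-- which the left action leaves unchanged and the right action conjugates by
-- g, while H n is normal and the right action on Z is conjugation.  For ρ,
-- the left action permutes the orbit G·x, and the right action commutes with
-- the left one, so it carries the closure of G·x onto that of G·(x·g).

module Equivariance (S : Setting) where
  open Setting S hiding (_∙_; _⁻¹; ε)

  group : Group _ _
  group = record { isGroup = isGroup }

  open Group group using (_∙_; _⁻¹; assoc; _\\_; _//_)
  open GroupProperties group
    using ( ⁻¹-involutive; ⁻¹-anti-homo-∙; \\-leftDividesˡ; \\-leftDividesʳ
          ; //-rightDividesˡ; //-rightDividesʳ )
  open ≡-Reasoning

  conj : G → G → G
  conj k a = k ∙ a ∙ k ⁻¹

  conj-⁻¹ : ∀ k a → conj (k ⁻¹) (conj k a) ≡ a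
  conj-⁻¹ k a = begin
    k ⁻¹ ∙ (k ∙ a ∙ k ⁻¹) ∙ k ⁻¹ ⁻¹  ≡⟨ cong (k ⁻¹ ∙ (k ∙ a ∙ k ⁻¹) ∙_) (⁻¹-involutive k) ⟩
    k ⁻¹ ∙ (k ∙ a ∙ k ⁻¹) ∙ k       ≡⟨ cong (_∙ k) (sym (assoc (k ⁻¹) (k ∙ a) (k ⁻¹))) ⟩
    k ⁻¹ ∙ (k ∙ a) ∙ k ⁻¹ ∙ k       ≡⟨ //-rightDividesˡ k (k \\ (k ∙ a)) ⟩
    k ⁻¹ ∙ (k ∙ a)                  ≡⟨ \\-leftDividesʳ k a ⟩
    a                               ∎

  H-resp-≡ : ∀ n {a b} → a ≡ b → H n a ⇔ H n b
  H-resp-≡ n refl = ⇔-id _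

  H-conj : ∀ n k {a} → H n a ⇔ H n (conj k a)
  H-conj n k {a} = mk⇔ (H-normal n k)
    (λ h → Equivalence.to (H-resp-≡ n (conj-⁻¹ k a)) (H-normal n (k ⁻¹) h))

  \\-∙ : ∀ g a h → (g ∙ a) \\ h ≡ a \\ (g \\ h)
  \\-∙ g a h = trans (cong (_∙ h) (⁻¹-anti-homo-∙ g a)) (assoc (a ⁻¹) (g ⁻¹) h)

  conj-\\-∙ : ∀ g a h → conj g ((a ∙ g) \\ h) ≡ a \\ (h // g)
  conj-\\-∙ g a h = begin
    g ∙ ((a ∙ g) \\ h) ∙ g ⁻¹     ≡⟨ cong (λ t → g ∙ t ∙ g ⁻¹) (\\-∙ a g h) ⟩
    g ∙ (g \\ (a \\ h)) ∙ g ⁻¹    ≡⟨ cong (_∙ g ⁻¹) (\\-leftDividesˡ g (a \\ h)) ⟩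
    (a \\ h) ∙ g ⁻¹               ≡⟨ assoc (a ⁻¹) h (g ⁻¹) ⟩
    a \\ (h // g)                 ∎

  σ-graph-cong : ∀ {y y' : Seq S} {z z' : Zraw S} {h h' : G} {b : Bool} →
    (∀ n → SameCoset S y n h ⇔ SameCoset S y' n h') →
    (∀ n → z n (y n \\ h) ≡ z' n (y' n \\ h')) →
    σ-graph S y z h b ⇔ σ-graph S y' z' h' b
  σ-graph-cong same val = mk⇔
    (λ (n₀ , new , old , zb) →
      n₀ , (λ s → new (from (same n₀) s)) , (λ m m< → to (same m) (old m m<)) ,
      trans (sym (val n₀)) zb)
    (λ (n₀ , new , old , zb) →
      n₀ , (λ s → new (to (same n₀) s)) , (λ m m< → from (same m) (old m m<)) ,
      trans (val n₀) zb)
    where open Equivalence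

  σ-graph-·ˡ : ∀ y z g h b → σ-graph S (_·Ŷˡ_ S g y) z h b ⇔ σ-graph S y z (g \\ h) b
  σ-graph-·ˡ y z g h b =
    σ-graph-cong {z = z} {z' = z}
      (λ n → H-resp-≡ n (\\-∙ g (y n) h))
      (λ n → cong (z n) (\\-∙ g (y n) h))

  σ-graph-·ʳ : ∀ y z g h b →
    σ-graph S (_·Ŷʳ_ S y g) (_·Zʳ_ S z g) h b ⇔ σ-graph S y z (h // g) b
  σ-graph-·ʳ y z g h b =
    σ-graph-cong {z = _·Zʳ_ S z g} {z' = z}
      (λ n → H-resp-≡ n (conj-\\-∙ g (y n) h) ⇔-∘ H-conj n g)
      (λ n → cong (z n) (conj-\\-∙ g (y n) h))

  ·ˡ-∙ : ∀ k g x → _·ˡ_ S k (_·ˡ_ S g x) ≗ _·ˡ_ S (k ∙ g) x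
  ·ˡ-∙ k g x h = cong x (sym (\\-∙ k g h))

  ·ˡ-·ʳ-comm : ∀ k x g → _·ˡ_ S k (_·ʳ_ S x g) ≗ _·ʳ_ S (_·ˡ_ S k x) g
  ·ˡ-·ʳ-comm k x g h = cong x (assoc (k ⁻¹) h (g ⁻¹))

  ·ʳ-·ʳ-⁻¹ : ∀ x g → _·ʳ_ S (_·ʳ_ S x g) (g ⁻¹) ≗ x
  ·ʳ-·ʳ-⁻¹ x g h =
    cong x (trans (cong (λ t → h ∙ t ∙ g ⁻¹) (⁻¹-involutive g)) (//-rightDividesʳ g h))

  ·ʳ-⁻¹-·ʳ : ∀ x g → _·ʳ_ S (_·ʳ_ S x (g ⁻¹)) g ≗ x
  ·ʳ-⁻¹-·ʳ x g h =
    cong x (trans (cong (h ∙ g ⁻¹ ∙_) (⁻¹-involutive g)) (//-rightDividesˡ g h))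

  InRho-resp : ∀ {x x' w w'} → x ≗ x' → w ≗ w' → InRho S x w → InRho S x' w'
  InRho-resp x≗x' w≗w' r F =
    let (k , agree) = r F in
    k , λ h h∈F → trans (sym (x≗x' _)) (trans (agree h h∈F) (w≗w' h))

  InRho-orbit-⊆ : ∀ {x x' w} → (∀ k → ∃[ k' ] _·ˡ_ S k' x' ≗ _·ˡ_ S k x) →
    InRho S x w → InRho S x' w
  InRho-orbit-⊆ orbit r F =
    let (k , agree) = r F ; (k' , same) = orbit k in
    k' , λ h h∈F → trans (same h) (agree h h∈F)

  InRho-·ˡ : ∀ x g w → InRho S (_·ˡ_ S g x) w ⇔ InRho S x w
  InRho-·ˡ x g w = mk⇔
    (InRho-orbit-⊆ {x = _·ˡ_ S g x} {x' = x} λ k → k ∙ g , λ h → sym (·ˡ-∙ k g x h))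
    (InRho-orbit-⊆ {x = x} {x' = _·ˡ_ S g x} λ k → k // g , λ h →
      trans (·ˡ-∙ (k // g) g x h) (cong (λ t → _·ˡ_ S t x h) (//-rightDividesˡ g k)))

  InRho-·ʳ : ∀ x w g → InRho S x w → InRho S (_·ʳ_ S x g) (_·ʳ_ S w g)
  InRho-·ʳ x w g r F =
    let (k , agree) = r (map (_// g) F) in
    k , λ h h∈F → trans (·ˡ-·ʳ-comm k x g h) (agree (h // g) (∈-map⁺ (_// g) h∈F))

  InRho-·ʳ-⇔ : ∀ x g w → InRho S (_·ʳ_ S x g) w ⇔ InRightTranslate S (InRho S x) g w
  InRho-·ʳ-⇔ x g w = mk⇔
    (λ r → _·ʳ_ S w (g ⁻¹) ,
           InRho-resp (·ʳ-·ʳ-⁻¹ x g) (λ _ → refl) (InRho-·ʳ (_·ʳ_ S x g) w (g ⁻¹) r) ,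
           λ h → sym (·ʳ-⁻¹-·ʳ w g h))
    (λ (v , rv , w≗v·g) →
       InRho-resp {x' = _·ʳ_ S x g} (λ _ → refl) (λ h → sym (w≗v·g h)) (InRho-·ʳ x v g rv))

lemma4p1 : (S : Setting) → Lemma4-1 S
lemma4p1 S =
  (λ y z _ _ → σ-graph-·ˡ y z) ,
  (λ y z _ _ → σ-graph-·ʳ y z) ,
  InRho-·ˡ ,
  InRho-·ʳ-⇔
  where open Equivariance S
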